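{- Let $\Gamma$ be a nonempty finite set, $\mathcal B\subseteq\mathcal P(\Gamma)$, and let $I_1,\dots,I_t$ together with operations $I_i=K_{i_1}\star_iK_{i_2}$ be a syntactic sequence. Then for every $j\ge t$ and every $i\in[t]$, $I_i^{j+1}=I_i^j$.
   Context: A syntactic sequence is a list of formal symbols $I_1,\dots,I_t$ together with, for each $i\in[t]$, an operation $I_i=K_{i_1}\star_iK_{i_2}$ with $K_{i_1},K_{i_2}\in\{I_1,\dots,I_t\}\cup\mathcal B$ and $\star_i\in\{\cap,\cup\}$ (the indices of operands are unrestricted, so cycles are allowed). It is evaluated by setting $I_i^0=\emptyset$ for all $i$ and, for $j>0$, $I_i^j=I_i^{j-1}\cup(K_{i_1}^{j-1}\star_iK_{i_2}^{j-1})$, where each generator $B\in\mathcal B$ has value $B$ at every stage. -}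

module Defs where

open import Data.Nat using (ℕ; zero; suc)
open import Data.Fin using (Fin)
open import Data.Fin.Subset using (Subset; _∩_; _∪_; ⊥)
open import Data.Sum using (_⊎_; inj₁; inj₂)
open import Data.Product using (Σ; proj₁)
open import Level using (0ℓ)
open import Relation.Unary using (Pred)

-- The ground set Γ is Fin n; subsets of Γ are 'Subset n'.
-- The family 𝓑 ⊆ 𝒫(Γ) is a predicate on subsets.

data Op : Set where
  cap cup : Op

applyOp : ∀ {n} → Op → Subset n → Subset n → Subset n
applyOp cap A B = A ∩ B
applyOp cup A B = A ∪ B

-- An operand is either a formal symbol I_k (k ∈ [t]) or a generator B ∈ 𝓑.
Operand : (n t : ℕ) → Pred (Subset n) 0ℓ → Set
Operand n t 𝓑 = Fin t ⊎ Σ (Subset n) 𝓑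

record SyntacticSeq (n : ℕ) (𝓑 : Pred (Subset n) 0ℓ) : Set where
  field
    t     : ℕ
    op    : Fin t → Op
    left  : Fin t → Operand n t 𝓑
    right : Fin t → Operand n t 𝓑

open SyntacticSeq public

mutual
  stage : ∀ {n 𝓑} (S : SyntacticSeq n 𝓑) → ℕ → Fin (t S) → Subset n
  stage S zero    i = ⊥
  stage S (suc j) i =
    stage S j i ∪ applyOp (op S i) (operandVal S j (left S i)) (operandVal S j (right S i))

  operandVal : ∀ {n 𝓑} (S : SyntacticSeq n 𝓑) → ℕ → Operand n (t S) 𝓑 → Subset n
  operandVal S j (inj₁ k) = stage S j k
  operandVal S j (inj₂ B) = proj₁ B

-- Membership of a fixed point x evolves independently of all other points: the set
-- of symbols I_i whose value contains x at stage j + 1 is obtained from the set at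
-- stage j by an inflationary map on subsets of [t]. An orbit of an inflationary
-- self-map of the powerset of a t-element set grows strictly in cardinality until
-- it becomes stationary, hence it is stationary from step t on.
module Submission where

open import Defs
open import Data.Bool using (Bool; _∧_; _∨_)
open import Data.Empty using (⊥-elim)
open import Data.Fin using (Fin)
open import Data.Fin.Subset using (Subset; _∪_; _⊆_; ∣_∣; inside; outside)
open import Data.Fin.Subset.Properties using (∣p∣≤n; p⊆q⇒∣p∣≤∣q∣; drop-∷-⊆)
open import Data.Nat using (ℕ; _≤_; _<_; zero; suc; s≤s; z≤n)
open import Data.Nat.Properties using (≤-trans; <-≤-trans; <⇒≱)
open import Data.Product using (proj₁)
open import Data.Sum using (_⊎_; inj₁; inj₂)
import Data.Sum as Sum
open import Data.Vec using ([]; _∷_; lookup; tabulate; here)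
open import Data.Vec.Properties
  using (lookup-zipWith; lookup∘tabulate; tabulate∘lookup; tabulate-cong;
         []=⇒lookup; lookup⇒[]=)
open import Function using (id)
open import Level using (0ℓ)
open import Relation.Unary using (Pred)
open import Relation.Binary.PropositionalEquality using (_≡_; refl; sym; trans; cong; cong₂)
open Relation.Binary.PropositionalEquality.≡-Reasoning

p⊆q⇒p≡q⊎∣p∣<∣q∣ : ∀ {m} {p q : Subset m} → p ⊆ q → p ≡ q ⊎ ∣ p ∣ < ∣ q ∣
p⊆q⇒p≡q⊎∣p∣<∣q∣ {p = []}          {[]}          _   = inj₁ refl
p⊆q⇒p≡q⊎∣p∣<∣q∣ {p = outside ∷ p} {outside ∷ q} p⊆q =
  Sum.map (cong (outside ∷_)) id (p⊆q⇒p≡q⊎∣p∣<∣q∣ (drop-∷-⊆ p⊆q))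
p⊆q⇒p≡q⊎∣p∣<∣q∣ {p = outside ∷ p} {inside  ∷ q} p⊆q = inj₂ (s≤s (p⊆q⇒∣p∣≤∣q∣ (drop-∷-⊆ p⊆q)))
p⊆q⇒p≡q⊎∣p∣<∣q∣ {p = inside  ∷ p} {outside ∷ q} p⊆q with () ← p⊆q here
p⊆q⇒p≡q⊎∣p∣<∣q∣ {p = inside  ∷ p} {inside  ∷ q} p⊆q =
  Sum.map (cong (inside ∷_)) s≤s (p⊆q⇒p≡q⊎∣p∣<∣q∣ (drop-∷-⊆ p⊆q))

module InflationaryOrbit {m : ℕ} (f : Subset m → Subset m) (f-inflationary : ∀ p → p ⊆ f p)
                         (s : ℕ → Subset m) (s-orbit : ∀ j → s (suc j) ≡ f (s j)) where

  s-⊆-suc : ∀ j → s j ⊆ s (suc j)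
  s-⊆-suc j x∈sj rewrite s-orbit j = f-inflationary (s j) x∈sj

  stationary-persists : ∀ j → s (suc j) ≡ s j → s (suc (suc j)) ≡ s (suc j)
  stationary-persists j eq = begin
    s (suc (suc j)) ≡⟨ s-orbit (suc j) ⟩
    f (s (suc j))   ≡⟨ cong f eq ⟩
    f (s j)         ≡⟨ s-orbit j ⟨
    s (suc j)       ∎

  stationary⊎j<∣s[1+j]∣ : ∀ j → s (suc j) ≡ s j ⊎ j < ∣ s (suc j) ∣
  stationary⊎j<∣s[1+j]∣ zero with p⊆q⇒p≡q⊎∣p∣<∣q∣ (s-⊆-suc 0)
  ... | inj₁ eq = inj₁ (sym eq)
  ... | inj₂ lt = inj₂ (≤-trans (s≤s z≤n) lt)
  stationary⊎j<∣s[1+j]∣ (suc j) with stationary⊎j<∣s[1+j]∣ j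
  ... | inj₁ eq = inj₁ (stationary-persists j eq)
  ... | inj₂ j<∣s[1+j]∣ with p⊆q⇒p≡q⊎∣p∣<∣q∣ (s-⊆-suc (suc j))
  ...   | inj₁ eq = inj₁ (sym eq)
  ...   | inj₂ lt = inj₂ (<-≤-trans (s≤s j<∣s[1+j]∣) lt)

  stationary : ∀ j → m ≤ j → s (suc j) ≡ s j
  stationary j m≤j with stationary⊎j<∣s[1+j]∣ j
  ... | inj₁ eq = eq
  ... | inj₂ j<∣s[1+j]∣ = ⊥-elim (<⇒≱ j<∣s[1+j]∣ (≤-trans (∣p∣≤n (s (suc j))) m≤j))

applyOpᴮ : Op → Bool → Bool → Bool
applyOpᴮ cap = _∧_
applyOpᴮ cup = _∨_

lookup-applyOp : ∀ {n} o (A B : Subset n) x →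
                 lookup (applyOp o A B) x ≡ applyOpᴮ o (lookup A x) (lookup B x)
lookup-applyOp cap A B x = lookup-zipWith _∧_ x A B
lookup-applyOp cup A B x = lookup-zipWith _∨_ x A B

module _ {n : ℕ} {𝓑 : Pred (Subset n) 0ℓ} (S : SyntacticSeq n 𝓑) where

  symbolsContaining : ℕ → Fin n → Subset (t S)
  symbolsContaining j x = tabulate λ i → lookup (stage S j i) x

  stage-transpose : ∀ j i → stage S j i ≡ tabulate λ x → lookup (symbolsContaining j x) i
  stage-transpose j i = begin
    stage S j i                                       ≡⟨ tabulate∘lookup (stage S j i) ⟨
    tabulate (lookup (stage S j i))                   ≡⟨ tabulate-cong (λ x → lookup∘tabulate _ i) ⟨
    tabulate (λ x → lookup (symbolsContaining j x) i) ∎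

  operandAt : Fin n → Subset (t S) → Operand n (t S) 𝓑 → Bool
  operandAt x c (inj₁ k) = lookup c k
  operandAt x c (inj₂ B) = lookup (proj₁ B) x

  operationAt : Fin n → Subset (t S) → Fin (t S) → Bool
  operationAt x c i = applyOpᴮ (op S i) (operandAt x c (left S i)) (operandAt x c (right S i))

  stepAt : Fin n → Subset (t S) → Subset (t S)
  stepAt x c = tabulate λ i → lookup c i ∨ operationAt x c i

  stepAt-inflationary : ∀ x c → c ⊆ stepAt x c
  stepAt-inflationary x c {i} i∈c =
    lookup⇒[]= i _ (trans (lookup∘tabulate _ i) (cong (_∨ operationAt x c i) ([]=⇒lookup i∈c)))

  lookup-operandVal : ∀ j x K → lookup (operandVal S j K) x ≡ operandAt x (symbolsContaining j x) K
  lookup-operandVal j x (inj₁ k) = sym (lookup∘tabulate _ k)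
  lookup-operandVal j x (inj₂ B) = refl

  symbolsContaining-suc : ∀ j x → symbolsContaining (suc j) x ≡ stepAt x (symbolsContaining j x)
  symbolsContaining-suc j x = tabulate-cong λ i → let L = left S i; R = right S i in begin
    lookup (stage S j i ∪ applyOp (op S i) (operandVal S j L) (operandVal S j R)) x
      ≡⟨ lookup-zipWith _∨_ x (stage S j i) _ ⟩
    lookup (stage S j i) x ∨ lookup (applyOp (op S i) (operandVal S j L) (operandVal S j R)) x
      ≡⟨ cong₂ _∨_ (sym (lookup∘tabulate _ i)) (lookup-applyOp (op S i) _ _ x) ⟩
    lookup (symbolsContaining j x) i ∨
      applyOpᴮ (op S i) (lookup (operandVal S j L) x) (lookup (operandVal S j R) x)
      ≡⟨ cong (lookup (symbolsContaining j x) i ∨_)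
              (cong₂ (applyOpᴮ (op S i)) (lookup-operandVal j x L) (lookup-operandVal j x R)) ⟩
    lookup (symbolsContaining j x) i ∨ operationAt x (symbolsContaining j x) i
      ∎

lemma2p13 : (n : ℕ) → 1 ≤ n → (𝓑 : Pred (Subset n) 0ℓ) → (S : SyntacticSeq n 𝓑) →
            (j : ℕ) → t S ≤ j → (i : Fin (t S)) → stage S (suc j) i ≡ stage S j i
lemma2p13 n _ 𝓑 S j t≤j i = begin
  stage S (suc j) i                                         ≡⟨ stage-transpose S (suc j) i ⟩
  tabulate (λ x → lookup (symbolsContaining S (suc j) x) i) ≡⟨ tabulate-cong column-stationary ⟩
  tabulate (λ x → lookup (symbolsContaining S j x) i)       ≡⟨ stage-transpose S j i ⟨
  stage S j i                                               ∎
  where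
  column-stationary : ∀ x → lookup (symbolsContaining S (suc j) x) i ≡ lookup (symbolsContaining S j x) i
  column-stationary x = cong (λ c → lookup c i)
    (InflationaryOrbit.stationary (stepAt S x) (stepAt-inflationary S x)
                                  (λ j → symbolsContaining S j x) (λ j → symbolsContaining-suc S j x) j t≤j)
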